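{- Let $k\geq 0$ be an integer and let $G=(V,E)$ be a graph having a clean $2$-branch $B$ with attachment points $P_1$ and $P_2$ such that $path(B)$ consists of at least $k+4$ critical cliques. If $P_1$ and $P_2$ belong to the same connected component of $G\setminus B^R$, then $G$ admits no $3$-leaf power completion of size at most $k$.
   Context: Graphs are finite, undirected and loopless. A graph $G=(V,E)$ is a $3$-leaf power if there exists a tree $T$ whose set of leaves is $V$ such that for distinct $u,v\in V$, $\{u,v\}\in E$ iff the distance between $u$ and $v$ in $T$ is at most $3$. For a set $F$ of unordered pairs of distinct vertices, $G+F=(V,E\triangle F)$; $F$ is a $3$-leaf power completion of $G$ if $F\cap E=\emptyset$ and $G+F$ is a $3$-leaf power. A module of $G$ is a set $S$ with $N(x)\setminus S=N(y)\setminus S$ for all $x,y\in S$; a critical clique is a clique which is a module, inclusion-maximal with this property. The critical clique graph $\mathcal{C}(G)$ has the critical cliques as vertices, $K,K'$ adjacent iff every vertex of $K$ is adjacent to every vertex of $K'$. A branch of $G$ is an induced subgraph $B=G[S]$ where $S$ is the disjoint union of critical cliques $K_1,\dots,K_r$ of $G$ such that the subgraph $\mathcal{C}(B)$ of $\mathcal{C}(G)$ induced by $\{K_1,\dots,K_r\}$ is a tree. A critical clique of $B$ is an attachment point of $B$ if it contains a vertex having a neighbor in $V\setminus S$; $B$ is a $2$-branch if it has exactly two attachment points $P_1,P_2$. $B^R$ is the subgraph of $B$ induced by $S\setminus(P_1\cup P_2)$, and $G\setminus B^R$ is the subgraph of $G$ induced by $V\setminus V(B^R)$. $path(B)$ is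 the subgraph of $G$ induced by the union of the critical cliques on the unique path from $P_1$ to $P_2$ in $\mathcal{C}(B)$. $B$ is clean if $P_1$ and $P_2$ are leaves of $\mathcal{C}(B)$. -}

module Defs where

open import Data.Nat using (ℕ; zero; suc; _+_; _≤_; _<ᵇ_)
open import Data.Fin using (Fin; toℕ)
open import Data.Bool using (Bool; true; false; _xor_; _∧_; if_then_else_)
open import Data.List using (List; []; _∷_; length; map; allFin)
open import Data.Nat.ListAction using (sum)
open import Data.List.Relation.Unary.All using (All)
open import Data.List.Relation.Unary.Unique.Propositional using (Unique)
open import Data.Product using (Σ; _×_; _,_; ∃)
open import Data.Sum using (_⊎_)
open import Relation.Nullary using (¬_)
open import Relation.Binary.PropositionalEquality using (_≡_; _≢_; refl; cong₂; trans)

record Graph (n : ℕ) : Set where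
  field
    adj    : Fin n → Fin n → Bool
    sym    : ∀ x y → adj x y ≡ adj y x
    irrefl : ∀ x → adj x x ≡ false

Adj : ∀ {n} → Graph n → Fin n → Fin n → Set
Adj G x y = Graph.adj G x y ≡ true

VSet : ℕ → Set
VSet n = Fin n → Bool

_∈_ : ∀ {n} → Fin n → VSet n → Set
x ∈ S = S x ≡ true

_∉_ : ∀ {n} → Fin n → VSet n → Set
x ∉ S = ¬ (x ∈ S)

_⊆_ : ∀ {n} → VSet n → VSet n → Set
S ⊆ S′ = ∀ x → x ∈ S → x ∈ S′

data Walk {A : Set} (R : A → A → Set) : A → A → Set where
  []  : ∀ {x} → Walk R x x
  _∷_ : ∀ {x y z} → R x y → Walk R y z → Walk R x z

len : ∀ {A : Set} {R : A → A → Set} {x y : A} → Walk R x y → ℕ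
len []      = 0
len (_ ∷ w) = suc (len w)

vertices : ∀ {A : Set} {R : A → A → Set} {x y : A} → Walk R x y → List A
vertices {x = x} []      = x ∷ []
vertices {x = x} (_ ∷ w) = x ∷ vertices w

IsPath : ∀ {A : Set} {R : A → A → Set} {x y : A} → Walk R x y → Set
IsPath w = Unique (vertices w)

Connected : ∀ {m} → (Fin m → Fin m → Set) → Set
Connected R = ∀ x y → Walk R x y

IsCycle : ∀ {A : Set} {R : A → A → Set} {x : A} → Walk R x x → Set
IsCycle []      = 3 ≤ 0
IsCycle (e ∷ w) = (3 ≤ suc (len w)) × Unique (vertices w)

Acyclic : ∀ {m} → (Fin m → Fin m → Set) → Set
Acyclic R = ∀ x → (w : Walk R x x) → ¬ IsCycle w

IsTree : ∀ {m} → (Fin m → Fin m → Set) → Set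
IsTree R = Connected R × Acyclic R

IsLeaf : ∀ {m} → (Fin m → Fin m → Set) → Fin m → Set
IsLeaf R x = Σ _ λ y → R x y × (∀ z → R x z → z ≡ y)

DistLe : ∀ {m} → (Fin m → Fin m → Set) → ℕ → Fin m → Fin m → Set
DistLe R d u v = Σ (Walk R u v) λ w → len w ≤ d

-- G is a 3-leaf power: there is a tree T whose leaf set is (a bijective
-- copy, via ι, of) V, with uv ∈ E iff dist_T(u,v) ≤ 3 for distinct u, v.
Is3LeafPower : ∀ {n} → Graph n → Set
Is3LeafPower {n} G =
  Σ ℕ λ m → Σ (Graph m) λ T → Σ (Fin n → Fin m) λ ι →
    IsTree (Adj T)
    × (∀ u v → ι u ≡ ι v → u ≡ v)
    × (∀ v → IsLeaf (Adj T) (ι v))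
    × (∀ t → IsLeaf (Adj T) t → Σ (Fin n) λ v → ι v ≡ t)
    × (∀ u v → u ≢ v →
         (Adj G u v → DistLe (Adj T) 3 (ι u) (ι v))
         × (DistLe (Adj T) 3 (ι u) (ι v) → Adj G u v))

-- a set F of unordered pairs of distinct vertices is itself given as a
-- (symmetric, loopless) graph on V; G + F has edge set E △ F
_⊕_ : ∀ {n} → Graph n → Graph n → Graph n
G ⊕ F = record
  { adj    = λ x y → Graph.adj G x y xor Graph.adj F x y
  ; sym    = λ x y → cong₂ _xor_ (Graph.sym G x y) (Graph.sym F x y)
  ; irrefl = λ x → trans (cong₂ _xor_ (Graph.irrefl G x) (Graph.irrefl F x)) refl
  }

size : ∀ {n} → Graph n → ℕ
size {n} F =
  sum (map (λ i → sum (map (λ j →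
    if (toℕ i <ᵇ toℕ j) ∧ Graph.adj F i j then 1 else 0) (allFin n))) (allFin n))

Is3LeafPowerCompletion : ∀ {n} → Graph n → Graph n → Set
Is3LeafPowerCompletion G F =
  (∀ x y → Adj F x y → ¬ Adj G x y) × Is3LeafPower (G ⊕ F)

IsClique : ∀ {n} → Graph n → VSet n → Set
IsClique G S = ∀ x y → x ∈ S → y ∈ S → x ≢ y → Adj G x y

IsModule : ∀ {n} → Graph n → VSet n → Set
IsModule G S = ∀ x y → x ∈ S → y ∈ S → ∀ z → z ∉ S →
  (Adj G x z → Adj G y z) × (Adj G y z → Adj G x z)

IsCriticalClique : ∀ {n} → Graph n → VSet n → Set
IsCriticalClique G K =
  IsClique G K × IsModule G K
  × (∀ S → IsClique G S → IsModule G S → K ⊆ S → S ⊆ K)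

record Branch {n} (G : Graph n) : Set where
  field
    r        : ℕ
    K        : Fin r → VSet n
    critical : ∀ i → IsCriticalClique G (K i)
    disjoint : ∀ i j x → x ∈ K i → x ∈ K j → i ≡ j

  InS : Fin n → Set
  InS x = Σ (Fin r) λ i → x ∈ K i

  CAdj : Fin r → Fin r → Set
  CAdj i j = i ≢ j × (∀ x y → x ∈ K i → y ∈ K j → Adj G x y)

  field
    tree : IsTree CAdj

  Attachment : Fin r → Set
  Attachment i = Σ (Fin n) λ x → x ∈ K i × Σ (Fin n) λ z → ¬ InS z × Adj G x z

  Is2Branch : Fin r → Fin r → Set
  Is2Branch p₁ p₂ = p₁ ≢ p₂ × Attachment p₁ × Attachment p₂
    × (∀ i → Attachment i → i ≡ p₁ ⊎ i ≡ p₂)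

  Clean : Fin r → Fin r → Set
  Clean p₁ p₂ = IsLeaf CAdj p₁ × IsLeaf CAdj p₂

  PathHasAtLeast : Fin r → Fin r → ℕ → Set
  PathHasAtLeast p₁ p₂ c =
    Σ (Walk CAdj p₁ p₂) λ w → IsPath w × c ≤ length (vertices w)

  InBR : Fin r → Fin r → Fin n → Set
  InBR p₁ p₂ x = InS x × x ∉ K p₁ × x ∉ K p₂

  SameComponentOutsideBR : Fin r → Fin r → Set
  SameComponentOutsideBR p₁ p₂ =
    Σ (Fin n) λ x → x ∈ K p₁ × Σ (Fin n) λ y → y ∈ K p₂ ×
      Σ (Walk (Adj G) x y) λ w → All (λ v → ¬ InBR p₁ p₂ v) (vertices w)

-- Let T be a tree realising G + F and call u, v near when their parents in T are equal or
-- adjacent; for distinct u, v this is adjacency in G + F. One vertex from each clique of path(B),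
-- closed up by a path through G ∖ B^R, forms a cycle of G on which the at least k + 2 vertices taken
-- from inner cliques of path(B) have no chords in G: those cliques are not attachment points and
-- C(B) is a tree. Consecutive vertices of the cycle are near, and as T is acyclic the parents cannot
-- go round without doubling back, so some vertex has near neighbours and can be cut off the cycle.
-- Inductively, each interior vertex but one is paid for by a chord at an interior vertex, that is,
-- by an edge of F; hence F has at least k + 1 edges.

module Submission where

open import Defs hiding (_∈_; _∉_)
open import Defs using () renaming (_∈_ to _∈ᵥ_)
open import Data.Nat using (ℕ; zero; suc; _+_; _≤_; _<_; _⊓_; _≤?_; _<ᵇ_; z≤n; s≤s)
open import Data.Nat.Properties
  using (≤-refl; ≤-trans; ≤-reflexive; ≤-pred; +-suc; +-comm; +-identityʳ; +-monoˡ-≤; +-monoʳ-≤;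
         m≤n+m; n≤1+n; ≰⇒>; <-irrefl; <-cmp; <⇒<ᵇ; <ᵇ⇒<; <-asym; +-cancelˡ-≤; n≤0⇒n≡0;
         m⊓n≤m; m⊓n≤n; m≥n⇒m⊓n≡n; ⊓-monoʳ-≤; 1+n≢0)
open import Data.Fin using (Fin; toℕ; _≟_) renaming (zero to fzero; suc to fsuc)
import Data.Fin.Properties as Finₚ
open import Data.Bool using (Bool; true; false; _∧_; _∨_; _xor_; not; if_then_else_; T)
import Data.Bool.Properties as Boolₚ
open import Data.List using (List; []; _∷_; _++_; [_]; length; map; take; allFin; tabulate)
import Data.List.Properties as Listₚ
open import Data.Nat.ListAction using (sum)
open import Data.Nat.ListAction.Properties using (sum-++; sum-↭)
open import Data.List.Relation.Unary.All as All using (All; []; _∷_)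
import Data.List.Relation.Unary.All.Properties as Allₚ
open import Data.List.Relation.Unary.Any using (here; there)
open import Data.List.Relation.Unary.Linked as Linked using (Linked; []; [-]; _∷_)
import Data.List.Relation.Unary.Linked.Properties as Linkedₚ
open import Data.List.Relation.Unary.AllPairs as AllPairs using ([]; _∷_)
open import Data.List.Relation.Unary.Unique.Propositional using (Unique)
import Data.List.Relation.Unary.Unique.Propositional.Properties as Uniqueₚ
open import Data.List.Membership.Propositional using (_∈_; _∉_)
open import Data.List.Membership.Propositional.Properties using (∈-++⁺ˡ; ∈-++⁺ʳ; ∈-++⁻; ∈-∃++; ∈-map⁻)
import Data.List.Membership.DecPropositional as DecMembership
open import Data.List.Relation.Binary.Permutation.Propositional using (_↭_; ↭-refl; ↭-sym; ↭-trans)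
import Data.List.Relation.Binary.Permutation.Propositional.Properties as Permₚ
open import Data.Product using (Σ; _×_; _,_; proj₁; proj₂; uncurry)
open import Data.Sum using (_⊎_; inj₁; inj₂)
open import Data.Nat.Solver using (module +-*-Solver)
open import Data.Empty using (⊥; ⊥-elim)
open import Data.Unit using (⊤; tt)
open import Function using (_∘_)
import Function.Bundles
open import Relation.Nullary using (¬_; yes; no; Dec)
open import Relation.Binary using (tri<; tri≈; tri>)
open import Relation.Nullary.Decidable using (⌊_⌋; does; decidable-stable; dec-true; dec-false)
open import Relation.Binary.PropositionalEquality
  using (_≡_; _≢_; refl; sym; trans; cong; cong₂; subst; subst₂; module ≡-Reasoning)

-- Lists read as cycles

module _ {A : Set} where

  links : List A → List (A × A)
  links (x ∷ y ∷ l) = (x , y) ∷ links (y ∷ l)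
  links _           = []

  closeUp : List A → List A
  closeUp l = l ++ take 1 l

  cyclicLinks : List A → List (A × A)
  cyclicLinks = links ∘ closeUp

  Adjacent : List A → A → A → Set
  Adjacent l a b = (a , b) ∈ links l ⊎ (b , a) ∈ links l

  CyclicallyAdjacent : List A → A → A → Set
  CyclicallyAdjacent = Adjacent ∘ closeUp

  unsnoc-∷ : ∀ (y : A) l → Σ (List A) λ init → Σ A λ z → y ∷ l ≡ init ++ [ z ]
  unsnoc-∷ y []       = [] , y , refl
  unsnoc-∷ y (y′ ∷ l) with unsnoc-∷ y′ l
  ... | init , z , eq = y ∷ init , z , cong (y ∷_) eq

  ∈-links-++⁺ˡ : ∀ l m {p} → p ∈ links l → p ∈ links (l ++ m)
  ∈-links-++⁺ˡ (x ∷ y ∷ l) m (here refl) = here refl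
  ∈-links-++⁺ˡ (x ∷ y ∷ l) m (there p∈)  = there (∈-links-++⁺ˡ (y ∷ l) m p∈)

  Adjacent-++⁺ˡ : ∀ l m {a b} → Adjacent l a b → Adjacent (l ++ m) a b
  Adjacent-++⁺ˡ l m (inj₁ ab∈) = inj₁ (∈-links-++⁺ˡ l m ab∈)
  Adjacent-++⁺ˡ l m (inj₂ ba∈) = inj₂ (∈-links-++⁺ˡ l m ba∈)

  Adjacent-swap : ∀ {l a b} → Adjacent l a b → Adjacent l b a
  Adjacent-swap (inj₁ ab∈) = inj₂ ab∈
  Adjacent-swap (inj₂ ba∈) = inj₁ ba∈

  Adjacent-∷ : ∀ x l {a b} → Adjacent l a b → Adjacent (x ∷ l) a b
  Adjacent-∷ x (y ∷ l) (inj₁ ab∈) = inj₁ (there ab∈)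
  Adjacent-∷ x (y ∷ l) (inj₂ ba∈) = inj₂ (there ba∈)

  links-++ : ∀ l a m → links (l ++ a ∷ m) ≡ links (l ++ [ a ]) ++ links (a ∷ m)
  links-++ []          a m = refl
  links-++ (x ∷ [])    a m = refl
  links-++ (x ∷ y ∷ l) a m = cong ((x , y) ∷_) (links-++ (y ∷ l) a m)

  links-∷ʳ : ∀ l a b → links ((l ++ [ a ]) ++ [ b ]) ≡ links (l ++ [ a ]) ++ [ (a , b) ]
  links-∷ʳ l a b = trans (cong links (Listₚ.++-assoc l [ a ] [ b ])) (links-++ l a [ b ])

  ∈-links : ∀ l a b m → (a , b) ∈ links (l ++ a ∷ b ∷ m)
  ∈-links []          a b m = here refl
  ∈-links (x ∷ [])    a b m = there (here refl)
  ∈-links (x ∷ y ∷ l) a b m = there (∈-links (y ∷ l) a b m)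

  ∈-links⇒∈ˡ : ∀ x l {a b} → (a , b) ∈ links (x ∷ l) → a ∈ x ∷ l
  ∈-links⇒∈ˡ x (y ∷ l) (here refl) = here refl
  ∈-links⇒∈ˡ x (y ∷ l) (there p)   = there (∈-links⇒∈ˡ y l p)

  ∈-links⇒∈ʳ : ∀ x l {a b} → (a , b) ∈ links (x ∷ l) → b ∈ l
  ∈-links⇒∈ʳ x (y ∷ l) (here refl) = here refl
  ∈-links⇒∈ʳ x (y ∷ l) (there p)   = there (∈-links⇒∈ʳ y l p)

  cyclicLinks-++-comm : ∀ l m → cyclicLinks (l ++ m) ↭ cyclicLinks (m ++ l)
  cyclicLinks-++-comm []      m rewrite Listₚ.++-identityʳ m = ↭-refl
  cyclicLinks-++-comm (x ∷ l) m = ↭-trans rotate-head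
    (subst₂ (λ s t → cyclicLinks s ↭ cyclicLinks t)
       (sym (Listₚ.++-assoc l m [ x ])) (Listₚ.++-assoc m [ x ] l)
       (cyclicLinks-++-comm l (m ++ [ x ])))
    where
    rotate-head : ∀ {y ys} → cyclicLinks (y ∷ ys) ↭ cyclicLinks (ys ++ [ y ])
    rotate-head {y} {[]}     = ↭-refl
    rotate-head {y} {z ∷ zs} =
      subst₂ _↭_ refl
        (trans (sym (links-++ (z ∷ zs) y [ z ])) (cong (links ∘ (z ∷_)) (sym (Listₚ.++-assoc zs [ y ] [ z ]))))
        (Permₚ.∷↭∷ʳ (y , z) (links (z ∷ zs ++ [ y ])))

  Linked⇒All-links : ∀ {R : A → A → Set} {l} → Linked R l → All (uncurry R) (links l)
  Linked⇒All-links []             = []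
  Linked⇒All-links [-]            = []
  Linked⇒All-links (r ∷ [-])      = r ∷ []
  Linked⇒All-links (r ∷ r′ ∷ rs)  = r ∷ Linked⇒All-links (r′ ∷ rs)

  Linked-++⁻ˡ : ∀ {R : A → A → Set} l {m} → Linked R (l ++ m) → Linked R l
  Linked-++⁻ˡ []          _        = []
  Linked-++⁻ˡ (x ∷ [])    _        = [-]
  Linked-++⁻ˡ (x ∷ y ∷ l) (r ∷ rs) = r ∷ Linked-++⁻ˡ (y ∷ l) rs

  Linked-join : ∀ {R : A → A → Set} l a m → Linked R (l ++ [ a ]) → Linked R (a ∷ m) → Linked R (l ++ a ∷ m)
  Linked-join []          a m _         rs = rs
  Linked-join (x ∷ [])    a m (r ∷ _)   rs = r ∷ rs
  Linked-join (x ∷ y ∷ l) a m (r ∷ rs′) rs = r ∷ Linked-join (y ∷ l) a m rs′ rs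

  Linked-∷ʳ : ∀ {R : A → A → Set} l a b → Linked R (l ++ [ a ]) → R a b → Linked R ((l ++ [ a ]) ++ [ b ])
  Linked-∷ʳ {R} l a b rs r =
    subst (Linked R) (sym (Listₚ.++-assoc l [ a ] [ b ])) (Linked-join l a [ b ] rs (r ∷ [-]))

module _ {A B : Set} (f : A → B) where

  ∈-links-map : ∀ l {a b} → (a , b) ∈ links l → (f a , f b) ∈ links (map f l)
  ∈-links-map (x ∷ y ∷ l) (here refl) = here refl
  ∈-links-map (x ∷ y ∷ l) (there ab∈) = there (∈-links-map (y ∷ l) ab∈)

  Adjacent-map : ∀ l {a b} → Adjacent l a b → Adjacent (map f l) (f a) (f b)
  Adjacent-map l (inj₁ ab∈) = inj₁ (∈-links-map l ab∈)
  Adjacent-map l (inj₂ ba∈) = inj₂ (∈-links-map l ba∈)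

module _ {A : Set} where

  Unique-++⁻ˡ : ∀ (xs : List A) {ys} → Unique (xs ++ ys) → Unique xs
  Unique-++⁻ˡ []       _          = []
  Unique-++⁻ˡ (x ∷ xs) (px ∷ u) = Allₚ.++⁻ˡ xs px ∷ Unique-++⁻ˡ xs u

  Unique-++⁻ʳ : ∀ (xs : List A) {ys} → Unique (xs ++ ys) → Unique ys
  Unique-++⁻ʳ []       u        = u
  Unique-++⁻ʳ (x ∷ xs) (_ ∷ u) = Unique-++⁻ʳ xs u

  Unique-++⇒∉ : ∀ (xs : List A) {ys v} → Unique (xs ++ ys) → v ∈ xs → v ∉ ys
  Unique-++⇒∉ (x ∷ xs) (px ∷ _) (here refl) v∈ys = All.lookup (Allₚ.++⁻ʳ xs px) v∈ys refl
  Unique-++⇒∉ (x ∷ xs) (_ ∷ u)  (there v∈xs) = Unique-++⇒∉ xs u v∈xs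

  Unique-++-comm : ∀ (xs ys : List A) → Unique (xs ++ ys) → Unique (ys ++ xs)
  Unique-++-comm xs ys u =
    Uniqueₚ.++⁺ (Unique-++⁻ʳ xs u) (Unique-++⁻ˡ xs u) (λ (v∈ys , v∈xs) → Unique-++⇒∉ xs u v∈xs v∈ys)

module _ {A : Set} {R : A → A → Set} where

  walkOf : ∀ x l y → Linked R (x ∷ l ++ [ y ]) → Walk R x y
  walkOf x []      y (r ∷ _)  = r ∷ []
  walkOf x (a ∷ l) y (r ∷ rs) = r ∷ walkOf a l y rs

  vertices-walkOf : ∀ x l y rs → vertices (walkOf x l y rs) ≡ x ∷ l ++ [ y ]
  vertices-walkOf x []      y (r ∷ _)  = refl
  vertices-walkOf x (a ∷ l) y (r ∷ rs) = cong (x ∷_) (vertices-walkOf a l y rs)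

  len-walkOf : ∀ x l y rs → len (walkOf x l y rs) ≡ suc (length l)
  len-walkOf x []      y (r ∷ _)  = refl
  len-walkOf x (a ∷ l) y (r ∷ rs) = cong suc (len-walkOf a l y rs)

  Linked-vertices : ∀ {x y} (w : Walk R x y) → Linked R (vertices w)
  Linked-vertices []           = [-]
  Linked-vertices (r ∷ [])     = r ∷ [-]
  Linked-vertices (r ∷ r′ ∷ w) = r ∷ Linked-vertices (r′ ∷ w)

  acyclic⇒¬closed : (∀ x (w : Walk R x x) → ¬ IsCycle w) →
                    ∀ x y l → 1 ≤ length l → Unique (x ∷ y ∷ l) → ¬ Linked R (x ∷ y ∷ l ++ [ x ])
  acyclic⇒¬closed acyclic x y l 1≤l u (r ∷ rs) = acyclic x (r ∷ walkOf y l x rs)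
    ( subst (3 ≤_) (sym (cong suc (len-walkOf y l x rs))) (s≤s (s≤s 1≤l))
    , subst Unique (sym (vertices-walkOf y l x rs)) (Unique-++-comm [ x ] (y ∷ l) u))

module _ {m} {R : Fin m → Fin m → Set} where

  initials : ∀ {x y} → Walk R x y → List (Fin m)
  initials     []      = []
  initials {x} (_ ∷ w) = x ∷ initials w

  vertices≡initials∷ʳ : ∀ {x y} (w : Walk R x y) → vertices w ≡ initials w ++ [ y ]
  vertices≡initials∷ʳ     []      = refl
  vertices≡initials∷ʳ {x} (_ ∷ w) = cong (x ∷_) (vertices≡initials∷ʳ w)

  ∈-vertices⁻ : ∀ {x y v} (w : Walk R x y) → v ∈ vertices w → v ∈ initials w ⊎ v ≡ y
  ∈-vertices⁻ w v∈w with ∈-++⁻ (initials w) (subst (_ ∈_) (vertices≡initials∷ʳ w) v∈w)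
  ... | inj₁ v∈i         = inj₁ v∈i
  ... | inj₂ (here refl) = inj₂ refl

  head∈vertices : ∀ {x y} (w : Walk R x y) → x ∈ vertices w
  head∈vertices []      = here refl
  head∈vertices (_ ∷ _) = here refl

  _++ᵂ_ : ∀ {x y z} → Walk R x y → Walk R y z → Walk R x z
  []      ++ᵂ q = q
  (r ∷ p) ++ᵂ q = r ∷ (p ++ᵂ q)

  ∈-vertices-++ᵂ⁻ : ∀ {x y z v} (p : Walk R x y) (q : Walk R y z) →
                    v ∈ vertices (p ++ᵂ q) → v ∈ vertices p ⊎ v ∈ vertices q
  ∈-vertices-++ᵂ⁻ []      q v∈         = inj₂ v∈
  ∈-vertices-++ᵂ⁻ (r ∷ p) q (here refl) = inj₁ (here refl)
  ∈-vertices-++ᵂ⁻ (r ∷ p) q (there v∈) with ∈-vertices-++ᵂ⁻ p q v∈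
  ... | inj₁ v∈p = inj₁ (there v∈p)
  ... | inj₂ v∈q = inj₂ v∈q

  firstHit : ∀ {P : Fin m → Set} → (∀ v → Dec (P v)) → ∀ {x y} (w : Walk R x y) → P y →
             Σ (Fin m) λ y′ → P y′ × Σ (Walk R x y′) λ w′ →
               All (¬_ ∘ P) (initials w′) × (∀ {v} → v ∈ vertices w′ → v ∈ vertices w)
  firstHit P? {x} [] py = x , py , [] , [] , λ v∈ → v∈
  firstHit P? {x} (r ∷ w) py with P? x
  ... | yes px = x , px , [] , [] , λ { (here refl) → here refl }
  ... | no ¬px with firstHit P? w py
  ...   | y′ , py′ , w′ , avoid , w′⊆w =
    y′ , py′ , r ∷ w′ , ¬px ∷ avoid , λ { (here refl) → here refl ; (there v∈) → there (w′⊆w v∈) }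

  suffixFrom : ∀ {x y v} (w : Walk R x y) → v ∈ vertices w →
               Σ (Walk R v y) λ w′ → Σ (List (Fin m)) λ pre → vertices w ≡ pre ++ vertices w′
  suffixFrom []            (here refl) = [] , [] , refl
  suffixFrom (r ∷ w)       (here refl) = r ∷ w , [] , refl
  suffixFrom {x} (r ∷ w)   (there v∈)  with suffixFrom w v∈
  ... | w′ , pre , eq = w′ , x ∷ pre , cong (x ∷_) eq

  toPath : ∀ {x y} (w : Walk R x y) →
           Σ (Walk R x y) λ p → IsPath p × (∀ {v} → v ∈ vertices p → v ∈ vertices w)
  toPath [] = [] , [] ∷ [] , λ v∈ → v∈
  toPath {x} (r ∷ w) with toPath w
  ... | p , p-path , p⊆w with DecMembership._∈?_ _≟_ x (vertices p)
  ...   | yes x∈p with suffixFrom p x∈p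
  ...     | p′ , pre , eq =
    p′ , Unique-++⁻ʳ pre (subst Unique eq p-path) ,
    λ v∈ → there (p⊆w (subst (_ ∈_) (sym eq) (∈-++⁺ʳ pre v∈)))
  toPath {x} (r ∷ w) | p , p-path , p⊆w | no x∉p =
    r ∷ p , Allₚ.¬Any⇒All¬ (vertices p) x∉p ∷ p-path ,
    λ { (here refl) → here refl ; (there v∈) → there (p⊆w v∈) }

module _ {m} {R : Fin m → Fin m → Set} (R-sym : ∀ {x y} → R x y → R y x) where

  reverse : ∀ {x y} → Walk R x y → Walk R y x
  reverse []      = []
  reverse (r ∷ w) = reverse w ++ᵂ (R-sym r ∷ [])

  ∈-vertices-reverse⁻ : ∀ {x y v} (w : Walk R x y) → v ∈ vertices (reverse w) → v ∈ vertices w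
  ∈-vertices-reverse⁻ []      v∈ = v∈
  ∈-vertices-reverse⁻ (r ∷ w) v∈ with ∈-vertices-++ᵂ⁻ (reverse w) (R-sym r ∷ []) v∈
  ... | inj₁ v∈w                 = there (∈-vertices-reverse⁻ w v∈w)
  ... | inj₂ (here refl)         = there (head∈vertices w)
  ... | inj₂ (there (here refl)) = here refl

  bridge : ∀ {P Q : Fin m → Set} → (∀ v → Dec (P v)) → (∀ v → Dec (Q v)) →
           ∀ {x y} (w : Walk R x y) → P x → Q y →
           Σ (Fin m) λ y′ → Σ (Fin m) λ x′ → Q y′ × P x′ × Σ (Walk R y′ x′) λ p → IsPath p ×
             (∀ {v} → v ∈ vertices p → v ≡ y′ ⊎ v ≡ x′ ⊎ (v ∈ vertices w × ¬ P v × ¬ Q v))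
  bridge {P} {Q} P? Q? w px qy with firstHit Q? w qy
  ... | y′ , qy′ , w₁ , w₁-avoids-Q , w₁⊆w with firstHit P? (reverse w₁) px
  ...   | x′ , px′ , w₂ , w₂-avoids-P , w₂⊆w₁ with toPath w₂
  ...     | p , p-path , p⊆w₂ = y′ , x′ , qy′ , px′ , p , p-path , classify
    where
    classify : ∀ {v} → v ∈ vertices p → v ≡ y′ ⊎ v ≡ x′ ⊎ (v ∈ vertices w × ¬ P v × ¬ Q v)
    classify v∈p with ∈-vertices⁻ w₂ (p⊆w₂ v∈p)
    ... | inj₂ v≡x′ = inj₂ (inj₁ v≡x′)
    ... | inj₁ v∈i₂ with ∈-vertices-reverse⁻ w₁ (w₂⊆w₁ (p⊆w₂ v∈p))
    ...   | v∈w₁ with ∈-vertices⁻ w₁ v∈w₁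
    ...     | inj₂ v≡y′ = inj₁ v≡y′
    ...     | inj₁ v∈i₁ = inj₂ (inj₂ (w₁⊆w v∈w₁ , All.lookup w₂-avoids-P v∈i₂ , All.lookup w₁-avoids-Q v∈i₁))

  module _ (acyclic : Acyclic R) where

    linked-no-chord : ∀ q q₁ l {b} → Unique (q ∷ q₁ ∷ l) → Linked R (q ∷ q₁ ∷ l) → b ∈ l → ¬ R q b
    linked-no-chord q q₁ l {b} u rs b∈l q~b with ∈-∃++ b∈l
    ... | M , S , refl = acyclic⇒¬closed acyclic q q₁ (M ++ [ b ])
      (subst (1 ≤_) (sym (Listₚ.length-++ M)) (m≤n+m 1 (length M)))
      (Unique-++⁻ˡ (q ∷ q₁ ∷ M ++ [ b ]) (subst Unique split u))
      (Linked-∷ʳ (q ∷ q₁ ∷ M) b q (Linked-++⁻ˡ (q ∷ q₁ ∷ M ++ [ b ]) (subst (Linked R) split rs)) (R-sym q~b))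
      where
      split : q ∷ q₁ ∷ M ++ b ∷ S ≡ (q ∷ q₁ ∷ M ++ [ b ]) ++ S
      split = cong (λ t → q ∷ q₁ ∷ t) (sym (Listₚ.++-assoc M [ b ] S))

    linked-chordless : ∀ {qs} → Unique qs → Linked R qs →
                       ∀ {i j} → i ∈ qs → j ∈ qs → i ≢ j → R i j → Adjacent qs i j
    linked-chordless {q ∷ l}      u       rs (here refl)         (here refl)         i≢j _   = ⊥-elim (i≢j refl)
    linked-chordless {q ∷ q₁ ∷ l} u       rs (here refl)         (there (here refl)) _   _   = inj₁ (here refl)
    linked-chordless {q ∷ q₁ ∷ l} u       rs (there (here refl)) (here refl)         _   _   = inj₂ (here refl)
    linked-chordless {q ∷ q₁ ∷ l} u       rs (here refl)         (there (there j∈))  _   q~j =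
      ⊥-elim (linked-no-chord q q₁ l u rs j∈ q~j)
    linked-chordless {q ∷ q₁ ∷ l} u       rs (there (there i∈))  (here refl)         _   i~q =
      ⊥-elim (linked-no-chord q q₁ l u rs i∈ (R-sym i~q))
    linked-chordless {q ∷ l}      (_ ∷ u) rs (there i∈)          (there j∈)          i≢j i~j =
      Adjacent-∷ q l (linked-chordless u (Linked.tail rs) i∈ j∈ i≢j i~j)

module _ {n} (G : Graph n) where

  Adj-sym : ∀ {x y} → Adj G x y → Adj G y x
  Adj-sym {x} {y} x~y = trans (Graph.sym G y x) x~y

  ¬Adj-self : ∀ x → ¬ Adj G x x
  ¬Adj-self x x~x with trans (sym x~x) (Graph.irrefl G x)
  ... | ()

  Adj⇒≢ : ∀ {x y} → Adj G x y → x ≢ y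
  Adj⇒≢ {x} x~y refl = ¬Adj-self x x~y

module _ {n} {G F : Graph n} where

  ⊕-keeps : (∀ x y → Adj F x y → ¬ Adj G x y) → ∀ {x y} → Adj G x y → Adj (G ⊕ F) x y
  ⊕-keeps F∩G=∅ {x} {y} x~y with Graph.adj F x y in F-xy
  ... | true  = ⊥-elim (F∩G=∅ x y F-xy x~y)
  ... | false rewrite x~y = refl

  ⊕-adds : ∀ {x y} → ¬ Adj G x y → Adj (G ⊕ F) x y → Adj F x y
  ⊕-adds {x} {y} x≁y x~y with Graph.adj G x y in G-xy
  ... | true  = ⊥-elim (x≁y refl)
  ... | false = x~y

sum-tabulate-bump : ∀ {m} (f g : Fin m → ℕ) a → (∀ i → i ≢ a → f i ≡ g i) → f a ≡ suc (g a) →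
                    sum (tabulate f) ≡ suc (sum (tabulate g))
sum-tabulate-bump f g fzero    f≗g fa≡ = cong₂ _+_ fa≡ (cong sum (Listₚ.tabulate-cong λ i → f≗g (fsuc i) λ ()))
sum-tabulate-bump f g (fsuc a) f≗g fa≡ = trans
  (cong₂ _+_ (f≗g fzero λ ())
             (sum-tabulate-bump (f ∘ fsuc) (g ∘ fsuc) a (λ i i≢a → f≗g (fsuc i) (i≢a ∘ Finₚ.suc-injective)) fa≡))
  (+-suc (g fzero) _)

module _ {n : ℕ} where

  sum-allFin : (f : Fin n → ℕ) → sum (map f (allFin n)) ≡ sum (tabulate f)
  sum-allFin f = cong sum (Listₚ.map-tabulate (λ i → i) f)

  orderedEdge : Graph n → Fin n → Fin n → ℕ
  orderedEdge F i j = if (toℕ i <ᵇ toℕ j) ∧ Graph.adj F i j then 1 else 0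

  orderedEdge-cong : ∀ (F F′ : Graph n) i j → (toℕ i < toℕ j → Graph.adj F i j ≡ Graph.adj F′ i j) →
                     orderedEdge F i j ≡ orderedEdge F′ i j
  orderedEdge-cong F F′ i j same with toℕ i <ᵇ toℕ j in i<ᵇj
  ... | false = refl
  ... | true  rewrite same (<ᵇ⇒< (toℕ i) (toℕ j) (subst T (sym i<ᵇj) tt)) = refl

  orderedEdge-< : ∀ (F : Graph n) i j → toℕ i < toℕ j → orderedEdge F i j ≡ (if Graph.adj F i j then 1 else 0)
  orderedEdge-< F i j i<j rewrite Function.Bundles.Equivalence.to Boolₚ.T-≡ (<⇒<ᵇ i<j) = refl

  size-bump : ∀ (F F′ : Graph n) a b →
              (∀ i j → ¬ (i ≡ a × j ≡ b) → orderedEdge F i j ≡ orderedEdge F′ i j) →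
              orderedEdge F a b ≡ suc (orderedEdge F′ a b) → size F ≡ suc (size F′)
  size-bump F F′ a b agree bump = begin
    size F                        ≡⟨ sum-allFin (row F) ⟩
    sum (tabulate (row F))        ≡⟨ sum-tabulate-bump (row F) (row F′) a other-row row-a ⟩
    suc (sum (tabulate (row F′))) ≡⟨ cong suc (sym (sum-allFin (row F′))) ⟩
    suc (size F′)                 ∎
    where
    open ≡-Reasoning
    row : Graph n → Fin n → ℕ
    row H i = sum (map (orderedEdge H i) (allFin n))
    other-row : ∀ i → i ≢ a → row F i ≡ row F′ i
    other-row i i≢a = cong sum (Listₚ.map-cong (λ j → agree i j (i≢a ∘ proj₁)) (allFin n))
    row-a : row F a ≡ suc (row F′ a)
    row-a = trans (sum-allFin _)
      (trans (sum-tabulate-bump _ _ b (λ j j≢b → agree a j (j≢b ∘ proj₂)) bump) (cong suc (sym (sum-allFin _))))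

  size-removeOrderedEdge : ∀ (F F′ : Graph n) lo hi → toℕ lo < toℕ hi → Adj F lo hi →
    (∀ x y → ¬ (x ≡ lo × y ≡ hi) → ¬ (x ≡ hi × y ≡ lo) → Graph.adj F′ x y ≡ Graph.adj F x y) →
    Graph.adj F′ lo hi ≡ false → size F ≡ suc (size F′)
  size-removeOrderedEdge F F′ lo hi lo<hi lo~hi agree lo≁hi = size-bump F F′ lo hi
    (λ i j ≢lohi → orderedEdge-cong F F′ i j λ i<j →
      sym (agree i j ≢lohi λ { (refl , refl) → <-asym lo<hi i<j }))
    (trans (orderedEdge-< F lo hi lo<hi)
      (trans (cong (λ e → if e then 1 else 0) lo~hi)
             (cong suc (sym (trans (orderedEdge-< F′ lo hi lo<hi) (cong (λ e → if e then 1 else 0) lo≁hi))))))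

  isEdge : Fin n → Fin n → Fin n → Fin n → Bool
  isEdge a b x y = (⌊ x ≟ a ⌋ ∧ ⌊ y ≟ b ⌋) ∨ (⌊ x ≟ b ⌋ ∧ ⌊ y ≟ a ⌋)

  isEdge-sym : ∀ a b x y → isEdge a b x y ≡ isEdge a b y x
  isEdge-sym a b x y = trans (Boolₚ.∨-comm (⌊ x ≟ a ⌋ ∧ ⌊ y ≟ b ⌋) _)
    (cong₂ _∨_ (Boolₚ.∧-comm ⌊ x ≟ b ⌋ _) (Boolₚ.∧-comm ⌊ x ≟ a ⌋ _))

  isEdge-other : ∀ a b x y → ¬ (x ≡ a × y ≡ b) → ¬ (x ≡ b × y ≡ a) → isEdge a b x y ≡ false
  isEdge-other a b x y ≢ab ≢ba with x ≟ a | y ≟ b | x ≟ b | y ≟ a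
  ... | yes p | yes q | _     | _     = ⊥-elim (≢ab (p , q))
  ... | _     | _     | yes p | yes q = ⊥-elim (≢ba (p , q))
  ... | no _  | _     | no _  | _     = refl
  ... | no _  | _     | yes _ | no _  = refl
  ... | yes _ | no _  | no _  | _     = refl
  ... | yes _ | no _  | yes _ | no _  = refl

  isEdge-self : ∀ a b → isEdge a b a b ≡ true
  isEdge-self a b with a ≟ a | b ≟ b
  ... | yes _ | yes _ = refl
  ... | no a≢a | _    = ⊥-elim (a≢a refl)
  ... | _     | no b≢b = ⊥-elim (b≢b refl)

  removeEdge : Graph n → Fin n → Fin n → Graph n
  removeEdge F a b = record
    { adj    = λ x y → Graph.adj F x y ∧ not (isEdge a b x y)
    ; sym    = λ x y → cong₂ (λ p q → p ∧ not q) (Graph.sym F x y) (isEdge-sym a b x y)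
    ; irrefl = λ x → cong (_∧ not (isEdge a b x x)) (Graph.irrefl F x)
    }

  removeEdge-other : ∀ F a b x y → ¬ (x ≡ a × y ≡ b) → ¬ (x ≡ b × y ≡ a) →
                     Graph.adj (removeEdge F a b) x y ≡ Graph.adj F x y
  removeEdge-other F a b x y ≢ab ≢ba
    rewrite isEdge-other a b x y ≢ab ≢ba = Boolₚ.∧-identityʳ (Graph.adj F x y)

  removeEdge-self : ∀ F a b → Graph.adj (removeEdge F a b) a b ≡ false
  removeEdge-self F a b rewrite isEdge-self a b = Boolₚ.∧-zeroʳ (Graph.adj F a b)

  size-removeEdge : ∀ F a b → Adj F a b → a ≢ b → size F ≡ suc (size (removeEdge F a b))
  size-removeEdge F a b a~b a≢b with <-cmp (toℕ a) (toℕ b)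
  ... | tri< a<b _ _ = size-removeOrderedEdge F (removeEdge F a b) a b a<b a~b
                         (removeEdge-other F a b) (removeEdge-self F a b)
  ... | tri≈ _ a≡b _ = ⊥-elim (a≢b (Finₚ.toℕ-injective a≡b))
  ... | tri> _ _ b<a = size-removeOrderedEdge F (removeEdge F a b) b a b<a (Adj-sym F a~b)
                         (λ x y ≢ba ≢ab → removeEdge-other F a b x y ≢ab ≢ba)
                         (trans (Graph.sym (removeEdge F a b) b a) (removeEdge-self F a b))

-- Chords forced on a cycle

module _ {A : Set} (R : A → A → Set) where

  Shortcut : List A → Set
  Shortcut ys = Σ A λ b → Σ A λ c → Σ (List A) λ mid → Σ A λ z → ys ≡ b ∷ c ∷ mid ++ [ z ] × R z c

  ShortcutFree : List A → Set
  ShortcutFree xs = ∀ l m → xs ≡ l ++ m → ¬ Shortcut (m ++ l)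

sum-map-↭ : ∀ {A : Set} (f : A → ℕ) {xs ys} → xs ↭ ys → sum (map f xs) ≡ sum (map f ys)
sum-map-↭ f xs↭ys = sum-↭ (Permₚ.map⁺ f xs↭ys)

sum-map-++ : ∀ {A : Set} (f : A → ℕ) xs ys → sum (map f (xs ++ ys)) ≡ sum (map f xs) + sum (map f ys)
sum-map-++ f xs ys = trans (cong sum (Listₚ.map-++ f xs ys)) (sum-++ (map f xs) (map f ys))

module CycleCounts {n : ℕ} (interior : Fin n → Bool) where

  indicator : Bool → ℕ
  indicator b = if b then 1 else 0

  #interior : List (Fin n) → ℕ
  #interior = sum ∘ map (indicator ∘ interior)

  #exterior : List (Fin n) → ℕ
  #exterior = sum ∘ map (indicator ∘ not ∘ interior)

  switch : Fin n × Fin n → ℕ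
  switch (a , b) = indicator (interior a xor interior b)

  switches : List (Fin n) → ℕ
  switches = sum ∘ map switch ∘ cyclicLinks

  switch-triangle : ∀ a b c → switch (a , c) ≤ switch (a , b) + switch (b , c)
  switch-triangle a b c with interior a | interior b | interior c
  ... | false | false | false = z≤n
  ... | false | false | true  = ≤-refl
  ... | false | true  | false = z≤n
  ... | false | true  | true  = ≤-refl
  ... | true  | false | false = ≤-refl
  ... | true  | false | true  = z≤n
  ... | true  | true  | false = ≤-refl
  ... | true  | true  | true  = z≤n

  switch-free⇒exterior : ∀ x l → sum (map switch (links (x ∷ l))) ≡ 0 → interior x ≡ false → #interior (x ∷ l) ≡ 0
  switch-free⇒exterior x []      _    x-ext rewrite x-ext = refl
  switch-free⇒exterior x (y ∷ l) none x-ext with interior y in y-int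
  ... | true  rewrite x-ext = ⊥-elim (1+n≢0 none)
  ... | false rewrite x-ext = subst (λ b → indicator b + #interior l ≡ 0) y-int
                                (switch-free⇒exterior y l none y-int)

  switch-same : ∀ {x y} → interior x ≡ interior y → switch (x , y) ≡ 0
  switch-same {x} {y} x≡y = cong indicator (trans (cong (_xor interior y) x≡y) (Boolₚ.xor-same (interior y)))

  switch-differ : ∀ {x y b} → interior x ≡ b → interior y ≡ not b → switch (x , y) ≡ 1
  switch-differ {b = true}  x≡b y≡¬b rewrite x≡b | y≡¬b = refl
  switch-differ {b = false} x≡b y≡¬b rewrite x≡b | y≡¬b = refl

  switches-constant : ∀ b l → All (λ v → interior v ≡ b) l → sum (map switch (links l)) ≡ 0
  switches-constant b []          _                 = refl
  switches-constant b (x ∷ [])    _                 = refl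
  switches-constant b (x ∷ y ∷ l) (x≡b ∷ y≡b ∷ l≡b) =
    cong₂ _+_ (switch-same (trans x≡b (sym y≡b))) (switches-constant b (y ∷ l) (y≡b ∷ l≡b))

  switches-run : ∀ b a l z → All (λ v → interior v ≡ b) (a ∷ l) → interior z ≡ not b →
                 sum (map switch (links (a ∷ l ++ [ z ]))) ≡ 1
  switches-run b a []      z (a≡b ∷ [])         z≡¬b = cong (_+ 0) (switch-differ a≡b z≡¬b)
  switches-run b a (y ∷ l) z (a≡b ∷ y≡b ∷ l≡b) z≡¬b =
    cong₂ _+_ (switch-same (trans a≡b (sym y≡b))) (switches-run b y l z (y≡b ∷ l≡b) z≡¬b)

  #interior-all : ∀ l → All (λ v → interior v ≡ true) l → #interior l ≡ length l
  #interior-all []      []            = refl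
  #interior-all (v ∷ l) (v-int ∷ int) rewrite v-int = cong suc (#interior-all l int)

  #interior-none : ∀ l → All (λ v → interior v ≡ false) l → #interior l ≡ 0
  #interior-none []      []            = refl
  #interior-none (v ∷ l) (v-ext ∷ ext) rewrite v-ext = #interior-none l ext

  #exterior-none : ∀ l → All (λ v → interior v ≡ true) l → #exterior l ≡ 0
  #exterior-none []      []            = refl
  #exterior-none (v ∷ l) (v-int ∷ int) rewrite v-int = #exterior-none l int

  #exterior-all : ∀ l → All (λ v → interior v ≡ false) l → #exterior l ≡ length l
  #exterior-all []      []            = refl
  #exterior-all (v ∷ l) (v-ext ∷ ext) rewrite v-ext = cong suc (#exterior-all l ext)

module ChordCounting {n : ℕ} (Near : Fin n → Fin n → Set) (interior : Fin n → Bool) where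

  open CycleCounts interior public

  InteriorChordsIn : Graph n → List (Fin n) → Set
  InteriorChordsIn F l = ∀ a b → a ∈ l → b ∈ l → a ≢ b → interior a ≡ true ⊎ interior b ≡ true →
                         ¬ CyclicallyAdjacent l a b → Near a b → Adj F a b

  -- switches≤2: the interior vertices form a single arc of the cycle.
  record ChordedCycle (F : Graph n) (l : List (Fin n)) : Set where
    field
      unique      : Unique l
      near        : All (uncurry Near) (cyclicLinks l)
      switches≤2  : switches l ≤ 2
      chords      : InteriorChordsIn F l

  -- A cycle of length ℓ in a chordal graph has ℓ − 3 chords; only chords at interior vertices
  -- are counted here, which is why the exterior contributes at most two.
  Bound : Graph n → List (Fin n) → Set
  Bound F l = #interior l + #exterior l ⊓ 2 ≤ size F + 3

  #interior+#exterior : ∀ l → #interior l + #exterior l ≡ length l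
  #interior+#exterior []      = refl
  #interior+#exterior (x ∷ l) with interior x
  ... | true  = cong suc (#interior+#exterior l)
  ... | false = trans (+-suc (#interior l) (#exterior l)) (cong suc (#interior+#exterior l))

  short⇒Bound : ∀ F l → length l ≤ 3 → Bound F l
  short⇒Bound F l l≤3 = ≤-trans (+-monoʳ-≤ (#interior l) (m⊓n≤m (#exterior l) 2))
    (≤-trans (≤-reflexive (#interior+#exterior l)) (≤-trans l≤3 (m≤n+m 3 (size F))))

  Bound-↭ : ∀ {F l m} → l ↭ m → Bound F m → Bound F l
  Bound-↭ {F} l↭m = subst₂ (λ i o → i + o ⊓ 2 ≤ size F + 3)
    (sum-map-↭ _ (↭-sym l↭m)) (sum-map-↭ _ (↭-sym l↭m))

  rotate : ∀ {F} l m → ChordedCycle F (l ++ m) → ChordedCycle F (m ++ l)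
  rotate l m cyc = record
    { unique     = Unique-++-comm l m unique
    ; near       = Permₚ.All-resp-↭ links↭ near
    ; switches≤2 = ≤-trans (≤-reflexive (sum-map-↭ switch (↭-sym links↭))) switches≤2
    ; chords     = λ a b a∈ b∈ a≢b int ¬adj → chords a b (∈↭ a∈) (∈↭ b∈) a≢b int
                     λ { (inj₁ ab∈) → ¬adj (inj₁ (Permₚ.∈-resp-↭ links↭ ab∈))
                       ; (inj₂ ba∈) → ¬adj (inj₂ (Permₚ.∈-resp-↭ links↭ ba∈)) }
    }
    where
    open ChordedCycle cyc
    links↭ = cyclicLinks-++-comm l m
    ∈↭ : ∀ {v} → v ∈ m ++ l → v ∈ l ++ m
    ∈↭ = Permₚ.∈-resp-↭ (Permₚ.++-comm m l)

  cons-bound : ∀ v l → #interior (v ∷ l) + #exterior (v ∷ l) ⊓ 2 ≤ suc (#interior l + #exterior l ⊓ 2)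
  cons-bound v l with interior v
  ... | true  = ≤-refl
  ... | false = ≤-trans (+-monoʳ-≤ (#interior l) (⊓-monoʳ-≤ (suc (#exterior l)) (n≤1+n 2)))
                        (≤-reflexive (+-suc (#interior l) (#exterior l ⊓ 2)))

  module Cut {F v c w mid′ z} (cyc : ChordedCycle F (v ∷ c ∷ w ∷ mid′ ++ [ z ])) (z~c : Near z c) where
    open ChordedCycle cyc

    mid zs : List (Fin n)
    mid = w ∷ mid′
    zs  = c ∷ mid ++ [ z ]

    cyclicLinks-ys : cyclicLinks (v ∷ zs) ≡ (v , c) ∷ links zs ++ [ (z , v) ]
    cyclicLinks-ys = cong ((v , c) ∷_) (links-∷ʳ (c ∷ mid) z v)

    cyclicLinks-zs : cyclicLinks zs ≡ links zs ++ [ (z , c) ]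
    cyclicLinks-zs = links-∷ʳ (c ∷ mid) z c

    ∈-cyclicLinks-ys⁻ : ∀ {p} → p ∈ cyclicLinks (v ∷ zs) → p ≡ (v , c) ⊎ p ∈ links zs ⊎ p ≡ (z , v)
    ∈-cyclicLinks-ys⁻ {p} p∈ with subst (p ∈_) cyclicLinks-ys p∈
    ... | here p≡vc = inj₁ p≡vc
    ... | there p∈′ with ∈-++⁻ (links zs) p∈′
    ...   | inj₁ p∈zs          = inj₂ (inj₁ p∈zs)
    ...   | inj₂ (here p≡zv)   = inj₂ (inj₂ p≡zv)

    zs-unique : Unique zs
    zs-unique = AllPairs.tail unique

    v∉zs : v ∉ zs
    v∉zs = Uniqueₚ.Unique[x∷xs]⇒x∉xs unique

    c∉ : c ∉ mid ++ [ z ]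
    c∉ = Uniqueₚ.Unique[x∷xs]⇒x∉xs zs-unique

    w∉ : w ∉ mid′ ++ [ z ]
    w∉ = Uniqueₚ.Unique[x∷xs]⇒x∉xs (AllPairs.tail zs-unique)

    z∈zs : z ∈ zs
    z∈zs = there (∈-++⁺ʳ mid (here refl))

    c≢z : c ≢ z
    c≢z c≡z = c∉ (subst (_∈ mid ++ [ z ]) (sym c≡z) (∈-++⁺ʳ mid (here refl)))

    zc-chord : ¬ CyclicallyAdjacent (v ∷ zs) z c
    zc-chord (inj₁ zc∈) with ∈-cyclicLinks-ys⁻ zc∈
    ... | inj₁ e         = v∉zs (subst (_∈ zs) (cong proj₁ e) z∈zs)
    ... | inj₂ (inj₁ m)  = c∉ (∈-links⇒∈ʳ c (mid ++ [ z ]) m)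
    ... | inj₂ (inj₂ e)  = v∉zs (subst (_∈ zs) (cong proj₂ e) (here refl))
    zc-chord (inj₂ cz∈) with ∈-cyclicLinks-ys⁻ cz∈
    ... | inj₁ e                 = v∉zs (subst (_∈ zs) (cong proj₁ e) (here refl))
    ... | inj₂ (inj₁ (here e))   = w∉ (subst (_∈ mid′ ++ [ z ]) (cong proj₂ e) (∈-++⁺ʳ mid′ (here refl)))
    ... | inj₂ (inj₁ (there m))  = c∉ (∈-links⇒∈ˡ w (mid′ ++ [ z ]) m)
    ... | inj₂ (inj₂ e)          = c≢z (cong proj₁ e)

    link-zs : ∀ {a b} → a ∈ zs → b ∈ zs → (a , b) ∈ cyclicLinks (v ∷ zs) → (a , b) ∈ cyclicLinks zs
    link-zs {a} {b} a∈ b∈ ab∈ with ∈-cyclicLinks-ys⁻ ab∈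
    ... | inj₁ e        = ⊥-elim (v∉zs (subst (_∈ zs) (cong proj₁ e) a∈))
    ... | inj₂ (inj₁ m) = subst ((a , b) ∈_) (sym cyclicLinks-zs) (∈-++⁺ˡ m)
    ... | inj₂ (inj₂ e) = ⊥-elim (v∉zs (subst (_∈ zs) (cong proj₂ e) b∈))

    adjacent-zs : ∀ {a b} → a ∈ zs → b ∈ zs → CyclicallyAdjacent (v ∷ zs) a b → CyclicallyAdjacent zs a b
    adjacent-zs a∈ b∈ (inj₁ ab∈) = inj₁ (link-zs a∈ b∈ ab∈)
    adjacent-zs a∈ b∈ (inj₂ ba∈) = inj₂ (link-zs b∈ a∈ ba∈)

    switches-ys : switches (v ∷ zs) ≡ switch (v , c) + (sum (map switch (links zs)) + (switch (z , v) + 0))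
    switches-ys = trans (cong (sum ∘ map switch) cyclicLinks-ys)
                        (cong (switch (v , c) +_) (sum-map-++ switch (links zs) _))

    switches-zs≤ : switches zs ≤ switches (v ∷ zs)
    switches-zs≤ = begin
      switches zs                            ≡⟨ cong (sum ∘ map switch) cyclicLinks-zs ⟩
      sum (map switch (links zs ++ [ (z , c) ])) ≡⟨ sum-map-++ switch (links zs) _ ⟩
      S + (switch (z , c) + 0)                ≤⟨ +-monoʳ-≤ S (+-monoˡ-≤ 0 (switch-triangle z v c)) ⟩
      S + ((switch (z , v) + switch (v , c)) + 0)
        ≡⟨ solve 3 (λ s a b → s :+ ((a :+ b) :+ con 0) := b :+ (s :+ (a :+ con 0)))
                   refl S (switch (z , v)) (switch (v , c)) ⟩
      switch (v , c) + (S + (switch (z , v) + 0)) ≡⟨ sym switches-ys ⟩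
      switches (v ∷ zs)                      ∎
      where
      open Data.Nat.Properties.≤-Reasoning
      open +-*-Solver
      S = sum (map switch (links zs))

    zs-cycle : ∀ F′ → (∀ a b → ¬ CyclicallyAdjacent zs a b → Adj F a b → Adj F′ a b) → ChordedCycle F′ zs
    zs-cycle F′ keep = record
      { unique     = zs-unique
      ; near       = subst (All (uncurry Near)) (sym cyclicLinks-zs)
                       (Allₚ.++⁺ (Allₚ.++⁻ˡ (links zs) (All.tail (subst (All (uncurry Near)) cyclicLinks-ys near)))
                                 (z~c ∷ []))
      ; switches≤2 = ≤-trans switches-zs≤ switches≤2
      ; chords     = λ a b a∈ b∈ a≢b int ¬adj a~b →
          keep a b ¬adj (chords a b (there a∈) (there b∈) a≢b int (¬adj ∘ adjacent-zs a∈ b∈) a~b)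
      }

    module _ (ih : ∀ {F′} → ChordedCycle F′ zs → Bound F′ zs) where

      -- zc is a chord at an interior vertex, hence an edge of F; deleting it pays for v.
      cut-interior : interior z ≡ true ⊎ interior c ≡ true → Bound F (v ∷ zs)
      cut-interior int = begin
        #interior (v ∷ zs) + #exterior (v ∷ zs) ⊓ 2 ≤⟨ cons-bound v zs ⟩
        suc (#interior zs + #exterior zs ⊓ 2)       ≤⟨ s≤s (ih (zs-cycle F′ keep)) ⟩
        suc (size F′ + 3)                   ≡⟨ cong (_+ 3) (sym (size-removeEdge F z c F~zc (c≢z ∘ sym))) ⟩
        size F + 3                          ∎
        where
        open Data.Nat.Properties.≤-Reasoning
        F′ = removeEdge F z c
        F~zc : Adj F z c
        F~zc = chords z c (there z∈zs) (there (here refl)) (c≢z ∘ sym) int zc-chord z~c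
        zc∈ : (z , c) ∈ cyclicLinks zs
        zc∈ = subst ((z , c) ∈_) (sym cyclicLinks-zs) (∈-++⁺ʳ (links zs) (here refl))
        keep : ∀ a b → ¬ CyclicallyAdjacent zs a b → Adj F a b → Adj F′ a b
        keep a b ¬adj a~b = trans (removeEdge-other F z c a b
          (λ { (refl , refl) → ¬adj (inj₁ zc∈) }) (λ { (refl , refl) → ¬adj (inj₂ zc∈) })) a~b

      cut-exterior : interior c ≡ false → interior z ≡ false → Bound F (v ∷ zs)
      cut-exterior c-ext z-ext with interior v in v-int
      ... | false = ≤-trans (+-monoʳ-≤ (#interior zs) (≤-reflexive (trans (m≥n⇒m⊓n≡n (≤-trans two≤ (n≤1+n _)))
                                                                     (sym (m≥n⇒m⊓n≡n two≤)))))
                            (ih (zs-cycle F λ _ _ _ a~b → a~b))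
        where
        two≤ : 2 ≤ #exterior zs
        two≤ = subst (2 ≤_) (sym (cong (λ b → indicator (not b) + #exterior (mid ++ [ z ])) c-ext))
          (s≤s (subst (1 ≤_) (sym (trans (sum-map-++ _ mid [ z ])
                                         (cong (λ b → #exterior mid + (indicator (not b) + 0)) z-ext)))
                      (m≤n+m 1 (#exterior mid))))
      ... | true = subst (λ i → suc (i + #exterior zs ⊓ 2) ≤ size F + 3) (sym zs-exterior)
                         (≤-trans (s≤s (m⊓n≤n (#exterior zs) 2)) (m≤n+m 3 (size F)))
        where
        path-switch-free : sum (map switch (links zs)) ≡ 0
        path-switch-free = only-two _ (subst₂ (λ a b → a + (sum (map switch (links zs)) + (b + 0)) ≤ 2)
          (cong₂ (λ a b → indicator (a xor b)) v-int c-ext) (cong₂ (λ a b → indicator (a xor b)) z-ext v-int)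
          (subst (_≤ 2) switches-ys switches≤2))
          where
          only-two : ∀ s → suc (s + 1) ≤ 2 → s ≡ 0
          only-two s le = n≤0⇒n≡0 (≤-pred (≤-pred (subst (_≤ 2) (cong suc (+-comm s 1)) le)))
        zs-exterior : #interior zs ≡ 0
        zs-exterior = switch-free⇒exterior c (mid ++ [ z ]) path-switch-free c-ext

    bound : (∀ {F′} → ChordedCycle F′ zs → Bound F′ zs) → Bound F (v ∷ zs)
    bound ih = by-cases (interior c) refl (interior z) refl
      where
      by-cases : ∀ bc → interior c ≡ bc → ∀ bz → interior z ≡ bz → Bound F (v ∷ zs)
      by-cases true  c-int _     _     = cut-interior ih (inj₂ c-int)
      by-cases false _     true  z-int = cut-interior ih (inj₁ z-int)
      by-cases false c-ext false z-ext = cut-exterior ih c-ext z-ext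

  chord-bound : (∀ xs → 3 ≤ length xs → All (uncurry Near) (cyclicLinks xs) → ¬ ShortcutFree Near xs) →
                ∀ {F l} → ChordedCycle F l → Bound F l
  chord-bound closed⇒¬ShortcutFree {l = l} = bounded (length l) ≤-refl
    where
    bounded : ∀ f {F l} → length l ≤ f → ChordedCycle F l → Bound F l
    bounded zero    {F} {l} l≤0 _ = short⇒Bound F l (≤-trans l≤0 z≤n)
    bounded (suc f) {F} {l} l≤f cyc with length l ≤? 3
    ... | yes l≤3 = short⇒Bound F l l≤3
    ... | no  l≰3 = decidable-stable (_ ≤? _) λ ¬bound →
      closed⇒¬ShortcutFree l (≤-trans (n≤1+n 3) (≰⇒> l≰3)) (ChordedCycle.near cyc) λ A B l≡AB shortcut →
        ¬bound (subst (Bound F) (sym l≡AB) (Bound-↭ {F} (Permₚ.++-comm A B)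
          (via-shortcut A B (subst (ChordedCycle F) l≡AB cyc) (subst (_≤ suc f) (cong length l≡AB) l≤f)
                        (subst (4 ≤_) (cong length l≡AB) (≰⇒> l≰3)) shortcut)))
      where
      via-shortcut : ∀ A B → ChordedCycle F (A ++ B) → length (A ++ B) ≤ suc f → 4 ≤ length (A ++ B) →
                     Shortcut Near (B ++ A) → Bound F (B ++ A)
      via-shortcut A B cyc′ _ 4≤ (b , c , [] , z , eq , _) =
        ⊥-elim (<-irrefl refl (subst (4 ≤_) (trans (Listₚ.length-++-comm A B) (cong length eq)) 4≤))
      via-shortcut A B cyc′ ≤suc-f _ (b , c , w ∷ mid′ , z , eq , z~c) =
        subst (Bound F) (sym eq) (Cut.bound (subst (ChordedCycle F) eq (rotate A B cyc′)) z~c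
          (bounded f (≤-pred (subst (_≤ suc f) (trans (Listₚ.length-++-comm A B) (cong length eq)) ≤suc-f))))

-- Trees admit no closed non-backtracking walks

module _ {m n} (T : Graph m) (parent : Fin n → Fin m) where

  Near : Fin n → Fin n → Set
  Near u v = parent u ≡ parent v ⊎ Adj T (parent u) (parent v)

  Turn : Fin n → Fin n → Fin n → Set
  Turn a b c = Adj T (parent a) (parent b) × Adj T (parent b) (parent c) × parent a ≢ parent c

  near-near-¬near⇒Turn : ∀ {a b c} → Near a b → Near b c → ¬ Near a c → Turn a b c
  near-near-¬near⇒Turn {a} {b} {c} a~b b~c a≁c = ab a~b b~c , bc a~b b~c , a≁c ∘ inj₁
    where
    ab : Near a b → Near b c → Adj T (parent a) (parent b)
    ab (inj₂ a~b)  _           = a~b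
    ab (inj₁ a≡b) (inj₁ b≡c)   = ⊥-elim (a≁c (inj₁ (trans a≡b b≡c)))
    ab (inj₁ a≡b) (inj₂ b~c)   = ⊥-elim (a≁c (inj₂ (subst (λ t → Adj T t (parent c)) (sym a≡b) b~c)))
    bc : Near a b → Near b c → Adj T (parent b) (parent c)
    bc _          (inj₂ b~c)   = b~c
    bc (inj₁ a≡b) (inj₁ b≡c)   = ⊥-elim (a≁c (inj₁ (trans a≡b b≡c)))
    bc (inj₂ a~b) (inj₁ b≡c)   = ⊥-elim (a≁c (inj₂ (subst (Adj T (parent a)) b≡c a~b)))

module _ {A : Set} where

  NonBacktracking : List A → Set
  NonBacktracking (a ∷ b ∷ c ∷ l) = a ≢ c × NonBacktracking (b ∷ c ∷ l)
  NonBacktracking _               = ⊤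

  NonBacktracking-tail : ∀ {x l} → NonBacktracking (x ∷ l) → NonBacktracking l
  NonBacktracking-tail {l = []}             _        = tt
  NonBacktracking-tail {l = _ ∷ []}         _        = tt
  NonBacktracking-tail {l = _ ∷ _ ∷ []}     _        = tt
  NonBacktracking-tail {l = _ ∷ _ ∷ _ ∷ _}  (_ , nb) = nb

module _ {m} (T : Graph m) (acyclic : Acyclic (Adj T)) where

  nonBacktracking-no-return : ∀ {x l} → Linked (Adj T) (x ∷ l) → NonBacktracking (x ∷ l) → Unique l → x ∉ l
  nonBacktracking-no-return {x} linked nb u x∈l with ∈-∃++ x∈l
  ... | []         , S , refl = ¬Adj-self T x (Linked.head linked)
  ... | y ∷ []     , S , refl = proj₁ nb refl
  ... | y ∷ y′ ∷ M , S , refl = acyclic⇒¬closed acyclic x y (y′ ∷ M) (s≤s z≤n)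
    (All.tabulate (λ v∈M x≡v → Unique-++⇒∉ (y ∷ y′ ∷ M) u (subst (_∈ y ∷ y′ ∷ M) (sym x≡v) v∈M) (here refl))
       ∷ Unique-++⁻ˡ (y ∷ y′ ∷ M) u)
    (Linked-++⁻ˡ (x ∷ y ∷ y′ ∷ M ++ [ x ])
       (subst (Linked (Adj T)) (cong (λ t → x ∷ y ∷ y′ ∷ t) (sym (Listₚ.++-assoc M [ x ] S))) linked))

  nonBacktracking⇒Unique : ∀ {l} → Linked (Adj T) l → NonBacktracking l → Unique l
  nonBacktracking⇒Unique {[]}    _      _  = []
  nonBacktracking⇒Unique {x ∷ l} linked nb =
    All.tabulate (λ y∈l x≡y → nonBacktracking-no-return linked nb u (subst (_∈ l) (sym x≡y) y∈l)) ∷ u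
    where
    u = nonBacktracking⇒Unique (Linked.tail linked) (NonBacktracking-tail nb)

  module _ {n} (parent : Fin n → Fin m) where

    module ShortcutFreeCycle (xs : List (Fin n)) (near : All (uncurry (Near T parent)) (cyclicLinks xs))
                             (free : ShortcutFree (Near T parent) xs) where

      near-at : ∀ A a b D → xs ≡ A ++ a ∷ b ∷ D → Near T parent a b
      near-at A a b D refl = All.lookup near
        (subst ((a , b) ∈_) (cong links (sym (Listₚ.++-assoc A (a ∷ b ∷ D) _))) (∈-links A a b _))

      turn-at : ∀ A a b c D → xs ≡ A ++ a ∷ b ∷ c ∷ D → Turn T parent a b c
      turn-at A a b c D eq =
        near-near-¬near⇒Turn T parent (near-at A a b (c ∷ D) eq) (near-at (A ++ [ a ]) b c D eq′)
        λ a~c → free (A ++ [ a ]) (b ∷ c ∷ D) eq′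
                  (b , c , D ++ A , a , cong (λ t → b ∷ c ∷ t) (sym (Listₚ.++-assoc D A [ a ])) , a~c)
        where
        eq′ : xs ≡ (A ++ [ a ]) ++ b ∷ c ∷ D
        eq′ = trans eq (sym (Listₚ.++-assoc A [ a ] (b ∷ c ∷ D)))

      linked-from : ∀ A a b c D → xs ≡ A ++ a ∷ b ∷ c ∷ D → Linked (Adj T) (map parent (a ∷ b ∷ c ∷ D))
      linked-from A a b c []      eq = proj₁ (turn-at A a b c [] eq) ∷ proj₁ (proj₂ (turn-at A a b c [] eq)) ∷ [-]
      linked-from A a b c (d ∷ D) eq = proj₁ (turn-at A a b c (d ∷ D) eq) ∷
        linked-from (A ++ [ a ]) b c d D (trans eq (sym (Listₚ.++-assoc A [ a ] (b ∷ c ∷ d ∷ D))))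

      nonBacktracking-from : ∀ A l → xs ≡ A ++ l → NonBacktracking (map parent l)
      nonBacktracking-from A (a ∷ b ∷ c ∷ D) eq = proj₂ (proj₂ (turn-at A a b c D eq)) ,
        nonBacktracking-from (A ++ [ a ]) (b ∷ c ∷ D) (trans eq (sym (Listₚ.++-assoc A [ a ] (b ∷ c ∷ D))))
      nonBacktracking-from A []               _  = tt
      nonBacktracking-from A (_ ∷ [])         _  = tt
      nonBacktracking-from A (_ ∷ _ ∷ [])     _  = tt

    -- The parents of a shortcut-free cycle would trace a cycle in T.
    closed⇒¬ShortcutFree : ∀ xs → 3 ≤ length xs → All (uncurry (Near T parent)) (cyclicLinks xs) →
                           ¬ ShortcutFree (Near T parent) xs
    closed⇒¬ShortcutFree (x₀ ∷ x₁ ∷ y ∷ r) _ near free with unsnoc-∷ y r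
    ... | mid , z , y∷r≡ = acyclic⇒¬closed acyclic (parent x₀) (parent x₁) (map parent mid ++ [ parent z ])
          (subst (1 ≤_) (sym (Listₚ.length-++ (map parent mid))) (m≤n+m 1 _))
          (subst Unique parents≡ (nonBacktracking⇒Unique linked (nonBacktracking-from [] xs refl)))
          (Linked-∷ʳ (parent x₀ ∷ parent x₁ ∷ map parent mid) (parent z) (parent x₀)
             (subst (Linked (Adj T)) parents≡ linked) (proj₁ (turn-at′ z~x₀ (near-at [] x₀ x₁ _ refl))))
      where
      open ShortcutFreeCycle (x₀ ∷ x₁ ∷ y ∷ r) near free
      xs = x₀ ∷ x₁ ∷ y ∷ r
      linked = linked-from [] x₀ x₁ y r refl
      parents≡ : map parent xs ≡ parent x₀ ∷ parent x₁ ∷ map parent mid ++ [ parent z ]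
      parents≡ = cong (λ t → parent x₀ ∷ parent x₁ ∷ t)
                      (trans (cong (map parent) y∷r≡) (Listₚ.map-++ parent mid [ z ]))
      z~x₀ : Near T parent z x₀
      z~x₀ = All.lookup near (subst ((z , x₀) ∈_)
        (cong (λ t → links (x₀ ∷ x₁ ∷ t))
              (trans (sym (Listₚ.++-assoc mid [ z ] [ x₀ ])) (cong (_++ [ x₀ ]) (sym y∷r≡))))
        (∈-links (x₀ ∷ x₁ ∷ mid) z x₀ []))
      turn-at′ : Near T parent z x₀ → Near T parent x₀ x₁ → Turn T parent z x₀ x₁
      turn-at′ z~x₀ x₀~x₁ = near-near-¬near⇒Turn T parent z~x₀ x₀~x₁ λ z~x₁ →
        free [] xs refl (x₀ , x₁ , mid , z , trans (Listₚ.++-identityʳ xs) (cong (λ t → x₀ ∷ x₁ ∷ t) y∷r≡) , z~x₁)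
    closed⇒¬ShortcutFree (_ ∷ [])     (s≤s ())
    closed⇒¬ShortcutFree (_ ∷ _ ∷ []) (s≤s (s≤s ()))

-- 3-leaf powers

module _ {n m} {T : Graph m} {ι : Fin n → Fin m} (leaf : ∀ v → IsLeaf (Adj T) (ι v)) where

  parent : Fin n → Fin m
  parent v = proj₁ (leaf v)

  ι~parent : ∀ v → Adj T (ι v) (parent v)
  ι~parent v = proj₁ (proj₂ (leaf v))

  parent-unique : ∀ v {t} → Adj T (ι v) t → t ≡ parent v
  parent-unique v = proj₂ (proj₂ (leaf v)) _

  module _ {H : Graph n} (ι-injective : ∀ u v → ι u ≡ ι v → u ≡ v)
    (dist : ∀ u v → u ≢ v →
            (Adj H u v → DistLe (Adj T) 3 (ι u) (ι v)) × (DistLe (Adj T) 3 (ι u) (ι v) → Adj H u v))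
    where

    near⇒adj : ∀ u v → u ≢ v → Near T parent u v → Adj H u v
    near⇒adj u v u≢v (inj₁ pu≡pv) = proj₂ (dist u v u≢v)
      (ι~parent u ∷ subst (λ t → Adj T t (ι v)) (sym pu≡pv) (Adj-sym T (ι~parent v)) ∷ [] , s≤s (s≤s z≤n))
    near⇒adj u v u≢v (inj₂ pu~pv) = proj₂ (dist u v u≢v)
      (ι~parent u ∷ pu~pv ∷ Adj-sym T (ι~parent v) ∷ [] , s≤s (s≤s (s≤s z≤n)))

    adj⇒near : ∀ u v → u ≢ v → Adj H u v → Near T parent u v
    adj⇒near u v u≢v u~v = let w , short = proj₁ (dist u v u≢v) u~v in from-walk w short refl refl
      where
      from-walk : ∀ {s t} (w : Walk (Adj T) s t) → len w ≤ 3 → s ≡ ι u → t ≡ ι v → Near T parent u v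
      from-walk []                  _ refl ιu≡ιv = ⊥-elim (u≢v (ι-injective u v ιu≡ιv))
      from-walk (e ∷ [])            _ refl refl  =
        inj₂ (subst₂ (Adj T) (parent-unique u e) (parent-unique v (Adj-sym T e)) (Adj-sym T e))
      from-walk (e₁ ∷ e₂ ∷ [])      _ refl refl  =
        inj₁ (trans (sym (parent-unique u e₁)) (parent-unique v (Adj-sym T e₂)))
      from-walk (e₁ ∷ e₂ ∷ e₃ ∷ []) _ refl refl  =
        inj₂ (subst₂ (Adj T) (parent-unique u e₁) (parent-unique v (Adj-sym T e₃)) e₂)
      from-walk (_ ∷ _ ∷ _ ∷ _ ∷ _) (s≤s (s≤s (s≤s ()))) _ _

module _ {n} {G : Graph n} (B : Branch G) where
  open Branch B

  CAdj-sym : ∀ {i j} → CAdj i j → CAdj j i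
  CAdj-sym (i≢j , K-adj) = i≢j ∘ sym , λ x y x∈ y∈ → Adj-sym G (K-adj y x y∈ x∈)

  adj⇒CAdj : ∀ {i j x y} → x ∈ᵥ K i → y ∈ᵥ K j → i ≢ j → Adj G x y → CAdj i j
  adj⇒CAdj {i} {j} {x} {y} x∈ y∈ i≢j x~y = i≢j , λ x′ y′ x′∈ y′∈ →
    let x′~y = proj₁ (module-K i x x′ x∈ x′∈ y (i≢j ∘ λ y∈i → disjoint i j y y∈i y∈)) x~y
    in Adj-sym G (proj₁ (module-K j y y′ y∈ y′∈ x′ (i≢j ∘ λ x′∈j → disjoint i j x′ x′∈ x′∈j)) (Adj-sym G x′~y))
    where
    module-K : ∀ i → IsModule G (K i)
    module-K i = proj₁ (proj₂ (critical i))

  -- Otherwise the clique module {x₀} would contain K i, contradicting maximality.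
  member : Fin n → ∀ i → Σ (Fin n) (_∈ᵥ K i)
  member x₀ i with Finₚ.any? (λ v → K i v Boolₚ.≟ true)
  ... | yes found = found
  ... | no  empty = ⊥-elim (empty (x₀ ,
    proj₂ (proj₂ (critical i)) single clique module′ (λ v v∈ → ⊥-elim (empty (v , v∈))) x₀ x₀∈))
    where
    single : VSet n
    single v = ⌊ v ≟ x₀ ⌋
    single≡ : ∀ {v} → v ∈ᵥ single → v ≡ x₀
    single≡ {v} v∈ with v ≟ x₀
    ... | yes v≡x₀ = v≡x₀
    x₀∈ : x₀ ∈ᵥ single
    x₀∈ with x₀ ≟ x₀
    ... | yes _   = refl
    ... | no x₀≢x₀ = ⊥-elim (x₀≢x₀ refl)
    clique : IsClique G single
    clique x y x∈ y∈ x≢y = ⊥-elim (x≢y (trans (single≡ x∈) (sym (single≡ y∈))))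
    module′ : IsModule G single
    module′ x y x∈ y∈ _ _ rewrite single≡ x∈ | single≡ y∈ = (λ a → a) , (λ a → a)

  outside-path : ∀ {p₁ p₂} → p₁ ≢ p₂ → SameComponentOutsideBR p₁ p₂ →
    Σ (Fin n) λ y′ → Σ (Fin n) λ x′ → y′ ∈ᵥ K p₂ × x′ ∈ᵥ K p₁ × Σ (List (Fin n)) λ L →
      Linked (Adj G) (y′ ∷ L ++ [ x′ ]) × Unique (y′ ∷ L ++ [ x′ ]) × All (¬_ ∘ InS) L
  outside-path {p₁} {p₂} p₁≢p₂ (x , x∈ , y , y∈ , w , w-avoids)
    with bridge (Adj-sym G) (λ v → K p₁ v Boolₚ.≟ true) (λ v → K p₂ v Boolₚ.≟ true) w x∈ y∈
  ... | y′ , x′ , y′∈ , x′∈ , [] , _ , _ = ⊥-elim (p₁≢p₂ (disjoint p₁ p₂ y′ x′∈ y′∈))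
  ... | y′ , x′ , y′∈ , x′∈ , e ∷ p , p-path , classify =
    y′ , x′ , y′∈ , x′∈ , initials p , subst (Linked (Adj G)) p≡ (Linked-vertices (e ∷ p)) , unique ,
    All.tabulate outside
    where
    p≡ : vertices (e ∷ p) ≡ y′ ∷ initials p ++ [ x′ ]
    p≡ = cong (y′ ∷_) (vertices≡initials∷ʳ p)
    unique : Unique (y′ ∷ initials p ++ [ x′ ])
    unique = subst Unique p≡ p-path
    outside : ∀ {v} → v ∈ initials p → ¬ InS v
    outside {v} v∈ v∈S with classify (subst (v ∈_) (sym p≡) (there (∈-++⁺ˡ v∈)))
    ... | inj₁ refl                         = Uniqueₚ.Unique[x∷xs]⇒x∉xs unique (∈-++⁺ˡ v∈)
    ... | inj₂ (inj₁ refl)                  = Unique-++⇒∉ (initials p) (AllPairs.tail unique) v∈ (here refl)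
    ... | inj₂ (inj₂ (v∈w , v∉K₁ , v∉K₂)) = All.lookup w-avoids v∈w (v∈S , v∉K₁ , v∉K₂)

  clique-path : ∀ {p₁ p₂ c} → p₁ ≢ p₂ → PathHasAtLeast p₁ p₂ c →
    Σ (List (Fin r)) λ inner →
      Linked CAdj (p₁ ∷ inner ++ [ p₂ ]) × Unique (p₁ ∷ inner ++ [ p₂ ]) × c ≤ 2 + length inner
  clique-path p₁≢p₂ ([] , _ , _) = ⊥-elim (p₁≢p₂ refl)
  clique-path {p₁} {p₂} {c} _ (e ∷ w , w-path , long) =
    initials w , subst (Linked CAdj) w≡ (Linked-vertices (e ∷ w)) , subst Unique w≡ w-path ,
    subst (c ≤_) (cong suc (trans (cong length (vertices≡initials∷ʳ w))
                                  (trans (Listₚ.length-++ (initials w)) (+-comm _ 1)))) long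
    where
    w≡ : vertices (e ∷ w) ≡ p₁ ∷ initials w ++ [ p₂ ]
    w≡ = cong (p₁ ∷_) (vertices≡initials∷ʳ w)

  module BranchCycle {p₁ p₂ : Fin r} (attached : ∀ i → Attachment i → i ≡ p₁ ⊎ i ≡ p₂)
    {x′ y′ : Fin n} (x′∈ : x′ ∈ᵥ K p₁) (y′∈ : y′ ∈ᵥ K p₂) {L : List (Fin n)}
    (outside-linked : Linked (Adj G) (y′ ∷ L ++ [ x′ ])) (outside-unique : Unique (y′ ∷ L ++ [ x′ ]))
    (outside : All (¬_ ∘ InS) L)
    {q₀ : Fin r} {inner′ : List (Fin r)}
    (path-linked : Linked CAdj (p₁ ∷ q₀ ∷ inner′ ++ [ p₂ ])) (path-unique : Unique (p₁ ∷ q₀ ∷ inner′ ++ [ p₂ ]))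
    where

    inner qs : List (Fin r)
    inner = q₀ ∷ inner′
    qs    = p₁ ∷ inner ++ [ p₂ ]

    p₁≢p₂ : p₁ ≢ p₂
    p₁≢p₂ p₁≡p₂ = Uniqueₚ.Unique[x∷xs]⇒x∉xs path-unique (∈-++⁺ʳ inner (here p₁≡p₂))

    inner-not-end : ∀ {i} → i ∈ inner → i ≡ p₁ ⊎ i ≡ p₂ → ⊥
    inner-not-end i∈ (inj₁ refl) = Uniqueₚ.Unique[x∷xs]⇒x∉xs path-unique (∈-++⁺ˡ i∈)
    inner-not-end i∈ (inj₂ refl) = Unique-++⇒∉ inner (AllPairs.tail path-unique) i∈ (here refl)

    -- The ends are x′ and y′ so that the clique path joins up with the outside path.
    pick : Fin r → Fin n
    pick q with q ≟ p₁ | q ≟ p₂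
    ... | yes _ | _     = x′
    ... | no _  | yes _ = y′
    ... | no _  | no _  = proj₁ (member x′ q)

    pick∈ : ∀ q → pick q ∈ᵥ K q
    pick∈ q with q ≟ p₁ | q ≟ p₂
    ... | yes refl | _     = x′∈
    ... | no _     | yes refl = y′∈
    ... | no _     | no _  = proj₂ (member x′ q)

    pick-injective : ∀ {i j} → pick i ≡ pick j → i ≡ j
    pick-injective {i} {j} eq = disjoint i j (pick i) (pick∈ i) (subst (_∈ᵥ K j) (sym eq) (pick∈ j))

    pick-p₁ : pick p₁ ≡ x′
    pick-p₁ with p₁ ≟ p₁
    ... | yes _     = refl
    ... | no p₁≢p₁  = ⊥-elim (p₁≢p₁ refl)

    pick-p₂ : pick p₂ ≡ y′
    pick-p₂ with p₂ ≟ p₁ | p₂ ≟ p₂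
    ... | yes p₂≡p₁ | _        = ⊥-elim (p₁≢p₂ (sym p₂≡p₁))
    ... | no _      | yes _    = refl
    ... | no _      | no p₂≢p₂ = ⊥-elim (p₂≢p₂ refl)

    mids cycle : List (Fin n)
    mids  = map pick inner
    cycle = x′ ∷ mids ++ y′ ∷ L

    map-pick-qs : map pick qs ≡ x′ ∷ mids ++ [ y′ ]
    map-pick-qs = cong₂ _∷_ pick-p₁ (trans (Listₚ.map-++ pick inner [ p₂ ]) (cong (λ y → mids ++ [ y ]) pick-p₂))

    cycle≡ : cycle ≡ map pick qs ++ L
    cycle≡ = trans (cong (x′ ∷_) (sym (Listₚ.++-assoc mids [ y′ ] L))) (cong (_++ L) (sym map-pick-qs))

    ∉mids : ∀ {v j} → v ∈ᵥ K j → j ≡ p₁ ⊎ j ≡ p₂ → v ∉ mids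
    ∉mids {v} {j} v∈K j-end v∈ with ∈-map⁻ pick v∈
    ... | i , i∈ , refl =
      inner-not-end i∈ (subst (λ t → t ≡ p₁ ⊎ t ≡ p₂) (sym (disjoint i j v (pick∈ i) v∈K)) j-end)

    outside∉mids : ∀ {v} → v ∈ L → v ∉ mids
    outside∉mids v∈L v∈ with ∈-map⁻ pick {xs = inner} v∈
    ... | i , _ , refl = All.lookup outside v∈L (i , pick∈ i)

    interior : Fin n → Bool
    interior v = does (DecMembership._∈?_ _≟_ v mids)

    open CycleCounts interior

    mids-interior : All (λ v → interior v ≡ true) mids
    mids-interior = All.tabulate λ {v} → dec-true (DecMembership._∈?_ _≟_ v mids)

    outside-exterior : All (λ v → interior v ≡ false) (y′ ∷ L ++ [ x′ ])
    outside-exterior = All.tabulate λ {v} v∈ → dec-false (DecMembership._∈?_ _≟_ v mids) (∉ v∈)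
      where
      ∉ : ∀ {v} → v ∈ y′ ∷ L ++ [ x′ ] → v ∉ mids
      ∉ (here refl) = ∉mids y′∈ (inj₂ refl)
      ∉ (there v∈) with ∈-++⁻ L v∈
      ... | inj₁ v∈L         = outside∉mids v∈L
      ... | inj₂ (here refl) = ∉mids x′∈ (inj₁ refl)

    cycle-unique : Unique cycle
    cycle-unique = subst Unique (sym cycle≡) (Uniqueₚ.++⁺ (Uniqueₚ.map⁺ pick-injective path-unique)
      (Unique-++⁻ˡ L (AllPairs.tail outside-unique))
      λ (v∈ , v∈L) → let i , _ , v≡ = ∈-map⁻ pick {xs = qs} v∈
                     in All.lookup outside v∈L (i , subst (_∈ᵥ K i) (sym v≡) (pick∈ i)))

    closeUp-cycle : closeUp cycle ≡ (x′ ∷ mids) ++ y′ ∷ (L ++ [ x′ ])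
    closeUp-cycle = cong (x′ ∷_) (Listₚ.++-assoc mids (y′ ∷ L) [ x′ ])

    cycle-linked : Linked (Adj G) (closeUp cycle)
    cycle-linked = subst (Linked (Adj G)) (sym closeUp-cycle) (Linked-join (x′ ∷ mids) y′ (L ++ [ x′ ])
      (subst (Linked (Adj G)) map-pick-qs
        (Linkedₚ.map⁺ (Linked.map (λ {i} {j} i~j → proj₂ i~j _ _ (pick∈ i) (pick∈ j)) path-linked)))
      outside-linked)

    cycle-switches : switches cycle ≡ 2
    cycle-switches = begin
      switches cycle
        ≡⟨ cong (sum ∘ map switch) (trans (cong links closeUp-cycle) (links-++ (x′ ∷ mids) y′ (L ++ [ x′ ]))) ⟩
      sum (map switch (links (x′ ∷ mids ++ [ y′ ]) ++ links (y′ ∷ L ++ [ x′ ])))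
        ≡⟨ sum-map-++ switch (links (x′ ∷ mids ++ [ y′ ])) _ ⟩
      (switch (x′ , pick q₀) + sum (map switch (links (mids ++ [ y′ ]))))
        + sum (map switch (links (y′ ∷ L ++ [ x′ ])))
        ≡⟨ cong₂ _+_ (cong₂ _+_ (switch-differ (All.lookup outside-exterior x′∈outside) (All.head mids-interior))
                                (switches-run true (pick q₀) (map pick inner′) y′ mids-interior
                                              (All.head outside-exterior)))
                     (switches-constant false _ outside-exterior) ⟩
      2 ∎
      where
      open ≡-Reasoning
      x′∈outside : x′ ∈ y′ ∷ L ++ [ x′ ]
      x′∈outside = there (∈-++⁺ʳ L (here refl))

    interior-counts : #interior cycle + #exterior cycle ⊓ 2 ≡ length inner + 2
    interior-counts = begin
      #interior cycle + #exterior cycle ⊓ 2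
        ≡⟨ counts (sum-map-↭ (indicator ∘ interior) cycle↭) (sum-map-↭ (indicator ∘ not ∘ interior) cycle↭) ⟩
      #interior (mids ++ rim) + #exterior (mids ++ rim) ⊓ 2
        ≡⟨ counts (sum-map-++ (indicator ∘ interior) mids rim) (sum-map-++ (indicator ∘ not ∘ interior) mids rim) ⟩
      (#interior mids + #interior rim) + (#exterior mids + #exterior rim) ⊓ 2
        ≡⟨ counts (cong₂ _+_ (#interior-all mids mids-interior) (#interior-none rim rim-exterior))
                  (cong₂ _+_ (#exterior-none mids mids-interior) (#exterior-all rim rim-exterior)) ⟩
      (length mids + 0) + (suc (suc (length L))) ⊓ 2
        ≡⟨ cong₂ _+_ (trans (+-identityʳ _) (Listₚ.length-map pick inner)) (m≥n⇒m⊓n≡n (s≤s (s≤s z≤n))) ⟩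
      length inner + 2 ∎
      where
      open ≡-Reasoning
      counts : ∀ {i i′ o o′} → i ≡ i′ → o ≡ o′ → i + o ⊓ 2 ≡ i′ + o′ ⊓ 2
      counts = cong₂ (λ i o → i + o ⊓ 2)
      rim : List (Fin n)
      rim = x′ ∷ y′ ∷ L
      cycle↭ : cycle ↭ mids ++ rim
      cycle↭ = ↭-sym (Permₚ.shift x′ mids (y′ ∷ L))
      rim-exterior : All (λ v → interior v ≡ false) rim
      rim-exterior = All.lookup outside-exterior (there (∈-++⁺ʳ L (here refl)))
                   ∷ All.head outside-exterior ∷ Allₚ.++⁻ˡ L (All.tail outside-exterior)

    interior⇒∈ : ∀ {v} → interior v ≡ true → v ∈ mids
    interior⇒∈ {v} v-int with DecMembership._∈?_ _≟_ v mids in eq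
    ... | yes v∈ = v∈
    ... | no  _  with () ← trans (sym (cong does eq)) v-int

    interior-adj⇒adjacent : ∀ {a b} → a ∈ mids → b ∈ cycle → a ≢ b → Adj G a b → CyclicallyAdjacent cycle a b
    interior-adj⇒adjacent {a} {b} a∈ b∈ a≢b a~b
      with ∈-map⁻ pick {xs = inner} a∈ | ∈-++⁻ (map pick qs) (subst (b ∈_) cycle≡ b∈)
    ... | i , i∈ , refl | inj₂ b∈L =
      ⊥-elim (inner-not-end i∈ (attached i (pick i , pick∈ i , b , All.lookup outside b∈L , a~b)))
    ... | i , i∈ , refl | inj₁ b∈qs with ∈-map⁻ pick {xs = qs} b∈qs
    ...   | j , j∈ , refl = subst (λ l → CyclicallyAdjacent l (pick i) (pick j)) (sym cycle≡)
      (Adjacent-++⁺ˡ (map pick qs ++ L) _ (Adjacent-++⁺ˡ (map pick qs) L (Adjacent-map pick qs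
        (linked-chordless CAdj-sym (proj₂ tree) path-unique path-linked (there (∈-++⁺ˡ i∈)) j∈ i≢j
          (adj⇒CAdj (pick∈ i) (pick∈ j) i≢j a~b)))))
      where
      i≢j : i ≢ j
      i≢j = a≢b ∘ cong pick

    module _ (Near : Fin n → Fin n → Set) (F : Graph n) (G⇒Near : ∀ {a b} → Adj G a b → Near a b)
             (chord⇒F : ∀ {a b} → a ≢ b → Near a b → ¬ Adj G a b → Adj F a b) where
      open ChordCounting Near interior using (ChordedCycle)

      chorded : ChordedCycle F cycle
      chorded = record
        { unique     = cycle-unique
        ; near       = All.map G⇒Near (Linked⇒All-links cycle-linked)
        ; switches≤2 = ≤-reflexive cycle-switches
        ; chords     = λ a b a∈ b∈ a≢b int ¬adj a~b → chord⇒F a≢b a~b λ a~Gb → ¬adj (G-chord int a∈ b∈ a≢b a~Gb)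
        }
        where
        G-chord : ∀ {a b} → interior a ≡ true ⊎ interior b ≡ true → a ∈ cycle → b ∈ cycle → a ≢ b → Adj G a b →
                  CyclicallyAdjacent cycle a b
        G-chord (inj₁ a-int) a∈ b∈ a≢b a~b = interior-adj⇒adjacent (interior⇒∈ a-int) b∈ a≢b a~b
        G-chord (inj₂ b-int) a∈ b∈ a≢b a~b =
          Adjacent-swap (interior-adj⇒adjacent (interior⇒∈ b-int) a∈ (a≢b ∘ sym) (Adj-sym G a~b))

    completion-bound : ∀ (F : Graph n) → (∀ x y → Adj F x y → ¬ Adj G x y) → Is3LeafPower (G ⊕ F) →
                       length inner + 2 ≤ size F + 3
    completion-bound F F∩G=∅ (m , T , ι , (_ , acyclic) , ι-injective , leaf , _ , dist) =
      subst (_≤ size F + 3) interior-counts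
        (ChordCounting.chord-bound near interior (closed⇒¬ShortcutFree T acyclic tree-parent) (chorded near F
          (λ a~b → adj⇒near′ (Adj⇒≢ G a~b) (⊕-keeps {G = G} {F} F∩G=∅ a~b))
          (λ a≢b a~b a≁b → ⊕-adds {G = G} {F} a≁b (near⇒adj′ a≢b a~b))))
      where
      tree-parent = parent {T = T} {ι = ι} leaf
      near = Near T tree-parent
      adj⇒near′ : ∀ {a b} → a ≢ b → Adj (G ⊕ F) a b → near a b
      adj⇒near′ = adj⇒near {T = T} {ι} leaf {H = G ⊕ F} ι-injective dist _ _
      near⇒adj′ : ∀ {a b} → a ≢ b → near a b → Adj (G ⊕ F) a b
      near⇒adj′ = near⇒adj {T = T} {ι} leaf {H = G ⊕ F} ι-injective dist _ _


lemma10 : ∀ {n} (k : ℕ) (G : Graph n) (B : Branch G)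
          (p₁ p₂ : Fin (Branch.r B)) →
          Branch.Is2Branch B p₁ p₂ →
          Branch.Clean B p₁ p₂ →
          Branch.PathHasAtLeast B p₁ p₂ (k + 4) →
          Branch.SameComponentOutsideBR B p₁ p₂ →
          ¬ (Σ (Graph n) λ F → Is3LeafPowerCompletion G F × size F ≤ k)
lemma10 k G B p₁ p₂ (p₁≢p₂ , _ , _ , attached) _ long connected (F , (F∩G=∅ , leaf-power) , size≤k)
  with outside-path B p₁≢p₂ connected | clique-path B p₁≢p₂ long
... | _ | [] , _ , _ , k+4≤2 = <-irrefl refl (≤-trans (≤-trans (m≤n+m 4 k) k+4≤2) (n≤1+n 2))
... | _ , _ , y′∈ , x′∈ , _ , outside-linked , outside-unique , outside
    | _ ∷ _ , path-linked , path-unique , k+4≤ = <-irrefl refl (+-cancelˡ-≤ k 4 3 (begin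
      k + 4             ≤⟨ k+4≤ ⟩
      2 + length inner  ≡⟨ +-comm 2 (length inner) ⟩
      length inner + 2  ≤⟨ completion-bound F F∩G=∅ leaf-power ⟩
      size F + 3        ≤⟨ +-monoˡ-≤ 3 size≤k ⟩
      k + 3             ∎))
  where
  open BranchCycle B attached x′∈ y′∈ outside-linked outside-unique outside path-linked path-unique
  open Data.Nat.Properties.≤-Reasoning
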